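{- Let $n=p_1p_2\cdots p_k$, where $p_1,\dots,p_k$ are distinct primes. Then the Wiener index of the essential ideal graph $\mathcal{E}_{\mathbb{Z}_n}$ is $$W(\mathcal{E}_{\mathbb{Z}_n})=\frac12\sum_{t=1}^{k-1}\binom{k}{t}\big[2^{k+1}+2^t-2^{k-t}-7\big].$$
   Context: $\mathbb{Z}_n$ is the ring of integers modulo $n$. An ideal $I$ of a commutative ring $R$ is essential if $I\cap J\neq\{0\}$ for every nonzero ideal $J$ of $R$. The essential ideal graph $\mathcal{E}_{\mathbb{Z}_n}$ is the simple graph whose vertex set is the set of all nonzero proper ideals of $\mathbb{Z}_n$, two distinct vertices $I,K$ being adjacent if and only if $I+K$ is an essential ideal of $\mathbb{Z}_n$. For a connected graph $G$ with distance $d$, the Wiener index is $W(G)=\sum_{\{u,v\}} d(u,v)$, summed over unordered pairs of distinct vertices. -}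

module Defs where

open import Data.Nat using (ℕ; zero; suc; _+_; _*_; _∸_; _^_; _≤_; _<_; NonZero)
open import Data.Nat.DivMod using (_mod_)
open import Data.Nat.Combinatorics using (_C_)
open import Data.Fin using (Fin; toℕ)
open import Data.Fin.Subset using (Subset; _∈_)
open import Data.Nat.ListAction using (sum)
open import Data.List using (List; map; applyUpTo; allFin; filter)
open import Data.Product using (Σ; ∃; _×_)
open import Relation.Nullary using (¬_)
open import Relation.Binary.PropositionalEquality using (_≡_; _≢_)
open import Data.Fin.Properties using (_<?_)

module Zn (n : ℕ) .{{_ : NonZero n}} where

  0ₙ : Fin n
  0ₙ = 0 mod n

  _+ₙ_ : Fin n → Fin n → Fin n
  a +ₙ b = (toℕ a + toℕ b) mod n

  _*ₙ_ : Fin n → Fin n → Fin n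
  a *ₙ b = (toℕ a * toℕ b) mod n

  -ₙ_ : Fin n → Fin n
  -ₙ a = (n ∸ toℕ a) mod n

  record IsIdeal (I : Subset n) : Set where
    field
      zero∈  : 0ₙ ∈ I
      +-closed : ∀ a b → a ∈ I → b ∈ I → (a +ₙ b) ∈ I
      neg-closed : ∀ a → a ∈ I → (-ₙ a) ∈ I
      absorb : ∀ r a → a ∈ I → (r *ₙ a) ∈ I

  NonzeroSubset : Subset n → Set
  NonzeroSubset I = ∃ λ a → a ∈ I × a ≢ 0ₙ

  Proper : Subset n → Set
  Proper I = ¬ (∀ a → a ∈ I)

  IdealSum : Subset n → Subset n → Fin n → Set
  IdealSum I K x = ∃ λ b → ∃ λ c → b ∈ I × c ∈ K × x ≡ b +ₙ c

  Essential : (Fin n → Set) → Set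
  Essential E = ∀ (J : Subset n) → IsIdeal J → NonzeroSubset J →
                ∃ λ a → E a × a ∈ J × a ≢ 0ₙ

  IsVertex : Subset n → Set
  IsVertex I = IsIdeal I × NonzeroSubset I × Proper I

  EAdj : Subset n → Subset n → Set
  EAdj I K = I ≢ K × Essential (IdealSum I K)

module Graph {V : ℕ} (Adj : Fin V → Fin V → Set) where

  data Walk : Fin V → Fin V → ℕ → Set where
    here : ∀ {u} → Walk u u 0
    step : ∀ {u w v m} → Adj u w → Walk w v m → Walk u v (suc m)

  IsDistance : Fin V → Fin V → ℕ → Set
  IsDistance u v d = Walk u v d × (∀ m → Walk u v m → d ≤ m)

  wiener : (Fin V → Fin V → ℕ) → ℕ
  wiener d = sum (map (λ i → sum (map (λ j → d i j)
                   (filter (λ j → i <? j) (allFin V)))) (allFin V))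

-- The right-hand side times 2:  Σ_{t=1}^{k-1} C(k,t) [2^{k+1} + 2^t - 2^{k-t} - 7]
-- (each bracket is positive for 1 ≤ t ≤ k-1, so truncated subtraction is exact)

wienerFormula2 : ℕ → ℕ
wienerFormula2 k =
  sum (map (λ t → (k C t) * ((2 ^ (suc k) + 2 ^ t) ∸ (2 ^ (k ∸ t) + 7)))
           (applyUpTo suc (k ∸ 1)))

{-# OPTIONS --safe #-}
module Submission where

open import Defs
open import Data.Empty using (⊥-elim)
open import Data.Fin using (Fin; toℕ; fromℕ<)
open import Data.Fin.Properties using (toℕ-fromℕ<; toℕ-injective; toℕ<n) renaming (_<?_ to _<ᶠ?_)
open import Data.Fin.Subset using (Subset) renaming (_∈_ to _∈ˢ_)
open import Data.Fin.Subset.Properties using (⊆-antisym) renaming (_∈?_ to _∈ˢ?_)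
open import Data.List using (List; []; _∷_; map; filter; length; applyUpTo; allFin; _++_)
open import Data.List.Membership.Propositional using (_∈_; _∉_)
open import Data.List.Membership.Propositional.Properties
  using (∈-++⁻; ∈-++⁺ˡ; ∈-++⁺ʳ; ∈-map⁺; ∈-map⁻; ∈-filter⁺; ∈-filter⁻; ∈-allFin)
open import Data.List.Membership.Propositional.Properties.WithK using (unique∧set⇒bag)
open import Data.List.Properties using (map-cong-local; map-∘; length-++; length-map)
open import Data.List.Relation.Binary.BagAndSetEquality using (∼bag⇒↭)
open import Data.List.Relation.Binary.Permutation.Propositional using (_↭_)
open import Data.List.Relation.Binary.Permutation.Propositional.Properties using (map⁺; ↭-length)
open import Data.List.Relation.Unary.All using (All; []; _∷_)
import Data.List.Relation.Unary.All as All
import Data.List.Relation.Unary.All.Properties as All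
open import Data.List.Relation.Unary.AllPairs using ([]; _∷_)
open import Data.List.Relation.Unary.Any using (here; there)
open import Data.List.Relation.Unary.Unique.Propositional using (Unique)
import Data.List.Relation.Unary.Unique.Propositional.Properties as Unique
open import Data.Nat hiding (_<?_)
import Data.Nat as ℕ
open import Data.Nat.Combinatorics using (_C_; nCk≡nC[n∸k]; k>n⇒nCk≡0; nCk+nC[k+1]≡[n+1]C[k+1]; nCn≡1)
open import Data.Nat.Coprimality using (Coprime; coprime?; coprime-divisor; coprime-Bézout; gcd≡1⇒coprime)
import Data.Nat.Coprimality as Coprime
open import Data.Nat.Divisibility
open import Data.Nat.DivMod
open import Data.Nat.GCD using (gcd; gcd[m,n]∣m; gcd[m,n]∣n; gcd[m,n]≡0⇒m≡0; module Bézout)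
open import Data.Nat.ListAction using (sum; product)
open import Data.Nat.ListAction.Properties using (sum-↭)
open import Data.Nat.Primality
  using (Prime; prime⇒irreducible; euclidsLemma; prime⇒nonTrivial; prime⇒nonZero; productOfPrimes≢0)
open import Data.Nat.Properties hiding (_<?_)
open import Algebra.Properties.CommutativeSemigroup +-commutativeSemigroup
  using () renaming (interchange to +-interchange)
open import Data.Nat.Tactic.RingSolver using (solve-∀)
open import Data.Product using (Σ; ∃; _×_; _,_; proj₁; proj₂)
open import Data.Sum using (_⊎_; inj₁; inj₂)
open import Data.Vec using (tabulate)
open import Data.Vec.Properties using ([]=⇒lookup; lookup⇒[]=; lookup∘tabulate)
open import Function.Bundles using (_⇔_; mk⇔)
open import Function.Definitions using (Injective)
open import Relation.Nullary using (¬_; Dec; yes; no; does)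
open import Relation.Nullary.Decidable using (_×-dec_; dec-true)
open import Relation.Unary using (Pred; Decidable)
open import Relation.Binary.PropositionalEquality

-- Since n is squarefree, every ideal of ℤ_n consists of the multiples of a unique divisor
-- g ∣ n, so the vertices are the divisors 1 < g < n, and (g) + (h) is essential iff
-- gcd(g,h) = 1: otherwise the multiples of n/gcd(g,h) meet (g) + (h) only in 0.
-- Writing g′ = n/g, distinct vertices are at distance 1 if coprime, at distance 2
-- through gcd(g′,h′) if n ∤ gh, and otherwise at distance 3 along g, g′, h′, h, since
-- a common neighbour would be coprime to gh. Checking the cases, for vertices g, h
--   d(g,h) + 2[h = g] + [g, h coprime] + [h = g′] = 2 + [n ∣ gh];
-- summing over all g, h, and using that g ↦ g′ turns coprime pairs into pairs with
-- n ∣ gh, gives Σ_{g,h} d(g,h) = 2N² − 3N for N = 2^k − 2, which is also the value of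
-- the binomial sum.

_when_ : ∀ {p} {P : Set p} → ℕ → Dec P → ℕ
v when yes _ = v
v when no _  = 0

when-⇔ : ∀ {p q} {P : Set p} {Q : Set q} v → (P → Q) → (Q → P) →
         (P? : Dec P) (Q? : Dec Q) → v when P? ≡ v when Q?
when-⇔ v _   _   (yes _) (yes _) = refl
when-⇔ v _   _   (no _)  (no _)  = refl
when-⇔ v P→Q _   (yes p) (no ¬q) = ⊥-elim (¬q (P→Q p))
when-⇔ v _   Q→P (no ¬p) (yes q) = ⊥-elim (¬p (Q→P q))

module _ {a} {A : Set a} where

  sum-map-cong∈ : ∀ {f g : A → ℕ} xs → (∀ {x} → x ∈ xs → f x ≡ g x) →
                  sum (map f xs) ≡ sum (map g xs)
  sum-map-cong∈ xs f≡g = cong sum (map-cong-local (All.tabulate f≡g))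

  sum-map-+ : ∀ (f g : A → ℕ) xs →
              sum (map (λ x → f x + g x) xs) ≡ sum (map f xs) + sum (map g xs)
  sum-map-+ f g []       = refl
  sum-map-+ f g (x ∷ xs) = trans (cong (f x + g x +_) (sum-map-+ f g xs)) (+-interchange (f x) (g x) _ _)

  sum-map-const : ∀ c (xs : List A) → sum (map (λ _ → c) xs) ≡ c * length xs
  sum-map-const c []       = sym (*-zeroʳ c)
  sum-map-const c (x ∷ xs) = trans (cong (c +_) (sum-map-const c xs)) (sym (*-suc c (length xs)))

  sum-map-filter : ∀ {p} {P : Pred A p} (P? : Decidable P) (f : A → ℕ) xs →
                   sum (map f (filter P? xs)) ≡ sum (map (λ x → f x when P? x) xs)
  sum-map-filter P? f [] = refl
  sum-map-filter P? f (x ∷ xs) with P? x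
  ... | yes _ = cong (f x +_) (sum-map-filter P? f xs)
  ... | no _  = sum-map-filter P? f xs

  module _ {z : A} (v : ℕ) (_≟z : ∀ x → Dec (x ≡ z)) where

    sum-map-when-∉ : ∀ {xs} → z ∉ xs → sum (map (λ x → v when (x ≟z)) xs) ≡ 0
    sum-map-when-∉ {[]}     _  = refl
    sum-map-when-∉ {y ∷ ys} z∉ with y ≟z
    ... | yes refl = ⊥-elim (z∉ (here refl))
    ... | no _     = sum-map-when-∉ (λ z∈ys → z∉ (there z∈ys))

    sum-map-when-∈ : ∀ {xs} → Unique xs → z ∈ xs → sum (map (λ x → v when (x ≟z)) xs) ≡ v
    sum-map-when-∈ {y ∷ ys} (y∉ys ∷ _) z∈ with y ≟z
    ... | yes refl = trans (cong (v +_) (sum-map-when-∉ (λ y∈ys → All.lookup y∉ys y∈ys refl))) (+-identityʳ v)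
    sum-map-when-∈ {y ∷ ys} _       (here z≡y)  | no y≢z = ⊥-elim (y≢z (sym z≡y))
    sum-map-when-∈ {y ∷ ys} (_ ∷ u) (there z∈) | no _    = sum-map-when-∈ u z∈

  unique∧set⇒↭ : ∀ {xs ys : List A} → Unique xs → Unique ys → (∀ {z} → z ∈ xs ⇔ z ∈ ys) → xs ↭ ys
  unique∧set⇒↭ ux uy xs≈ys = ∼bag⇒↭ (unique∧set⇒bag ux uy xs≈ys)

module _ {a b} {A : Set a} {B : Set b} where

  sum-map-swap : ∀ (xs : List A) (ys : List B) (f : A → B → ℕ) →
                 sum (map (λ x → sum (map (f x) ys)) xs) ≡ sum (map (λ y → sum (map (λ x → f x y) xs)) ys)
  sum-map-swap []       ys f = sym (sum-map-const 0 ys)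
  sum-map-swap (x ∷ xs) ys f = trans (cong (sum (map (f x) ys) +_) (sum-map-swap xs ys f))
                                     (sym (sum-map-+ (f x) (λ y → sum (map (λ x → f x y) xs)) ys))

  Unique-map⁺-local : ∀ (f : A → B) {xs} → (∀ {x y} → x ∈ xs → y ∈ xs → f x ≡ f y → x ≡ y) →
                      Unique xs → Unique (map f xs)
  Unique-map⁺-local f {[]}     _   _            = []
  Unique-map⁺-local f {x ∷ xs} inj (x∉xs ∷ U) =
    All.map⁺ (All.tabulate (λ y∈xs fx≡fy → All.lookup x∉xs y∈xs (inj (here refl) (there y∈xs) fx≡fy)))
    ∷ Unique-map⁺-local f (λ x∈ y∈ → inj (there x∈) (there y∈)) U

module _ {V : ℕ} (Adj : Fin V → Fin V → Set) (d : Fin V → Fin V → ℕ) where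

  wiener-symmetric : (∀ i j → d i j ≡ d j i) → (∀ i → d i i ≡ 0) →
                     2 * Graph.wiener Adj d ≡ sum (map (λ i → sum (map (d i) (allFin V))) (allFin V))
  wiener-symmetric d-sym d-diag = begin
      2 * W                                                ≡⟨ cong (W +_) (+-identityʳ W) ⟩
      W + W                                                ≡⟨ cong₂ _+_ W≡upper W≡lower ⟩
      sum (map upper F) + sum (map lower F)              ≡⟨ sum-map-+ upper lower F ⟨
      sum (map (λ i → upper i + lower i) F)               ≡⟨ sum-map-cong∈ F (λ {i} _ → sym (sum-map-+ _ _ F)) ⟩
      sum (map (λ i → sum (map (λ j → (d i j when (i <ᶠ? j)) + (d i j when (j <ᶠ? i))) F)) F)
        ≡⟨ sum-map-cong∈ F (λ {i} _ → sum-map-cong∈ F (λ {j} _ → split i j)) ⟩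
      sum (map (λ i → sum (map (d i) F)) F)              ∎
    where
    open ≡-Reasoning
    F = allFin V
    W = Graph.wiener Adj d
    upper lower : Fin V → ℕ
    upper i = sum (map (λ j → d i j when (i <ᶠ? j)) F)
    lower i = sum (map (λ j → d i j when (j <ᶠ? i)) F)
    W≡upper : W ≡ sum (map upper F)
    W≡upper = sum-map-cong∈ F (λ {i} _ → sum-map-filter (i <ᶠ?_) (d i) F)
    W≡lower : W ≡ sum (map lower F)
    W≡lower = trans W≡upper (trans
      (sum-map-cong∈ F (λ {i} _ → sum-map-cong∈ F (λ {j} _ → cong (_when (i <ᶠ? j)) (d-sym i j))))
      (sum-map-swap F F (λ i j → d j i when (i <ᶠ? j))))
    split : ∀ i j → (d i j when (i <ᶠ? j)) + (d i j when (j <ᶠ? i)) ≡ d i j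
    split i j with i <ᶠ? j | j <ᶠ? i
    ... | yes _   | no _    = +-identityʳ _
    ... | no _    | yes _   = refl
    ... | yes i<j | yes j<i = ⊥-elim (<-asym i<j j<i)
    ... | no i≮j  | no j≮i  = sym (trans (cong (d i) (sym i≡j)) (d-diag i))
      where i≡j = toℕ-injective (≤-antisym (≮⇒≥ j≮i) (≮⇒≥ i≮j))

module _ {V : ℕ} {Adj : Fin V → Fin V → Set} where
  open Graph Adj

  walk₀⇒≡ : ∀ {i j} → Walk i j 0 → i ≡ j
  walk₀⇒≡ here = refl

  walk₁⇒adjacent : ∀ {i j} → Walk i j 1 → Adj i j
  walk₁⇒adjacent (step i~j here) = i~j

  walk₂⇒commonNeighbour : ∀ {i j} → Walk i j 2 → ∃ λ k → Adj i k × Adj k j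
  walk₂⇒commonNeighbour (step i~k (step k~j here)) = _ , i~k , k~j

-- Sums over ranges and the closed form of the right-hand side

∑< : ℕ → (ℕ → ℕ) → ℕ
∑< zero    f = 0
∑< (suc m) f = f 0 + ∑< m (λ i → f (suc i))

sum-map-applyUpTo : ∀ (g h : ℕ → ℕ) m → sum (map g (applyUpTo h m)) ≡ ∑< m (λ i → g (h i))
sum-map-applyUpTo g h zero    = refl
sum-map-applyUpTo g h (suc m) = cong (g (h 0) +_) (sum-map-applyUpTo g (λ i → h (suc i)) m)

∑<-cong : ∀ m {f g : ℕ → ℕ} → (∀ {i} → i < m → f i ≡ g i) → ∑< m f ≡ ∑< m g
∑<-cong zero    f≡g = refl
∑<-cong (suc m) f≡g = cong₂ _+_ (f≡g z<s) (∑<-cong m (λ i<m → f≡g (s<s i<m)))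

∑<-+ : ∀ m (f g : ℕ → ℕ) → ∑< m (λ i → f i + g i) ≡ ∑< m f + ∑< m g
∑<-+ zero    f g = refl
∑<-+ (suc m) f g = trans (cong (f 0 + g 0 +_) (∑<-+ m _ _)) (+-interchange (f 0) (g 0) _ _)

∑<-*ʳ : ∀ m (f : ℕ → ℕ) c → ∑< m (λ i → f i * c) ≡ ∑< m f * c
∑<-*ʳ zero    f c = refl
∑<-*ʳ (suc m) f c = trans (cong (f 0 * c +_) (∑<-*ʳ m _ c)) (sym (*-distribʳ-+ c (f 0) _))

∑<-snoc : ∀ m (f : ℕ → ℕ) → ∑< (suc m) f ≡ ∑< m f + f m
∑<-snoc zero    f = +-identityʳ (f 0)
∑<-snoc (suc m) f = trans (cong (f 0 +_) (∑<-snoc m _)) (sym (+-assoc (f 0) _ _))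

∑<-reverse : ∀ m (f : ℕ → ℕ) → ∑< m f ≡ ∑< m (λ i → f (m ∸ suc i))
∑<-reverse zero    f = refl
∑<-reverse (suc m) f = trans (∑<-snoc m f) (trans (+-comm (∑< m f) (f m)) (cong (f m +_) (∑<-reverse m f)))

∑<-∸ : ∀ m (f g : ℕ → ℕ) → (∀ {i} → i < m → g i ≤ f i) →
       ∑< m (λ i → f i ∸ g i) + ∑< m g ≡ ∑< m f
∑<-∸ m f g g≤f = trans (sym (∑<-+ m _ g)) (∑<-cong m (λ i<m → m∸n+n≡m (g≤f i<m)))

∑<-binomial : ∀ k → ∑< (suc k) (k C_) ≡ 2 ^ k
∑<-binomial zero    = refl
∑<-binomial (suc k) = begin
    1 + ∑< (suc k) (λ i → suc k C suc i)
  ≡⟨ cong (1 +_) (∑<-cong (suc k) (λ {i} _ → sym (nCk+nC[k+1]≡[n+1]C[k+1] k i))) ⟩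
    1 + ∑< (suc k) (λ i → k C i + k C suc i)
  ≡⟨ cong (1 +_) (∑<-+ (suc k) (k C_) (λ i → k C suc i)) ⟩
    1 + (∑< (suc k) (k C_) + ∑< (suc k) (λ i → k C suc i))
  ≡⟨ cong (λ s → 1 + (∑< (suc k) (k C_) + s)) (∑<-snoc k (λ i → k C suc i)) ⟩
    1 + (∑< (suc k) (k C_) + (∑< k (λ i → k C suc i) + k C suc k))
  ≡⟨ cong (λ c → 1 + (∑< (suc k) (k C_) + (∑< k (λ i → k C suc i) + c))) (k>n⇒nCk≡0 (n<1+n k)) ⟩
    1 + (∑< (suc k) (k C_) + (∑< k (λ i → k C suc i) + 0))
  ≡⟨ rearrange (∑< (suc k) (k C_)) (∑< k (λ i → k C suc i)) ⟩
    ∑< (suc k) (k C_) + ∑< (suc k) (k C_)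
  ≡⟨ cong₂ _+_ (∑<-binomial k) (trans (∑<-binomial k) (sym (+-identityʳ (2 ^ k)))) ⟩
    2 ^ k + (2 ^ k + 0)
  ∎
  where
  open ≡-Reasoning
  rearrange : ∀ a b → 1 + (a + (b + 0)) ≡ a + (1 + b)
  rearrange = solve-∀

∑<-interior-binomial : ∀ m → ∑< (suc m) (λ i → suc (suc m) C suc i) + 2 ≡ 2 ^ suc (suc m)
∑<-interior-binomial m = begin
    s + 2                  ≡⟨ +-comm s 2 ⟩
    1 + (1 + s)            ≡⟨ cong (1 +_) (+-comm 1 s) ⟩
    1 + (s + 1)            ≡⟨ cong (λ c → 1 + (s + c)) (sym (nCn≡1 k)) ⟩
    1 + (s + k C k)        ≡⟨ cong (1 +_) (∑<-snoc (suc m) (λ i → k C suc i)) ⟨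
    ∑< (suc k) (k C_)      ≡⟨ ∑<-binomial k ⟩
    2 ^ k                  ∎
  where
  open ≡-Reasoning
  k = suc (suc m)
  s = ∑< (suc m) (λ i → k C suc i)

∑<-binomial-weight-symmetric : ∀ m → let k = suc (suc m) in
  ∑< (suc m) (λ i → (k C suc i) * 2 ^ (k ∸ suc i)) ≡ ∑< (suc m) (λ i → (k C suc i) * 2 ^ suc i)
∑<-binomial-weight-symmetric m =
  trans (∑<-reverse (suc m) (λ i → (k C suc i) * 2 ^ (k ∸ suc i)))
        (∑<-cong (suc m) (λ i<1+m → weight (s≤s⁻¹ i<1+m)))
  where
  k = suc (suc m)
  weight : ∀ {i} → i ≤ m → (k C suc (m ∸ i)) * 2 ^ (k ∸ suc (m ∸ i)) ≡ (k C suc i) * 2 ^ suc i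
  weight {i} i≤m = begin
      (k C suc (m ∸ i)) * 2 ^ (k ∸ suc (m ∸ i))
    ≡⟨ cong (_* 2 ^ (k ∸ suc (m ∸ i))) (nCk≡nC[n∸k] {suc (m ∸ i)} {k} (s≤s (m≤n⇒m≤1+n (m∸n≤m m i)))) ⟩
      (k C (k ∸ suc (m ∸ i))) * 2 ^ (k ∸ suc (m ∸ i))
    ≡⟨ cong (λ t → (k C t) * 2 ^ t) k∸[1+m∸i]≡1+i ⟩
      (k C suc i) * 2 ^ suc i
    ∎
    where
    open ≡-Reasoning
    k∸[1+m∸i]≡1+i : k ∸ suc (m ∸ i) ≡ suc i
    k∸[1+m∸i]≡1+i = trans (+-∸-assoc 1 (m∸n≤m m i)) (cong suc (m∸[m∸n]≡n i≤m))

-- For 0 < t < k, Σ C(k,t) = 2^k − 2 and Σ C(k,t) 2^(k−t) = Σ C(k,t) 2^t, so the brackets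
-- sum to (2^(k+1) − 7)(2^k − 2).
wienerFormula2-closedForm : ∀ k → wienerFormula2 k + 3 * (2 ^ k ∸ 2) ≡ 2 * (2 ^ k ∸ 2) * (2 ^ k ∸ 2)
wienerFormula2-closedForm zero          = refl
wienerFormula2-closedForm (suc zero)    = refl
wienerFormula2-closedForm (suc (suc m)) = goal
  where
  k = suc (suc m)
  c A B : ℕ → ℕ
  c i = k C suc i
  A i = 2 ^ suc k + 2 ^ suc i
  B i = 2 ^ (k ∸ suc i) + 7
  N = ∑< (suc m) c
  P = ∑< (suc m) (λ i → c i * 2 ^ suc i)

  B≤A : ∀ {i} → i < suc m → B i ≤ A i
  B≤A {i} (s≤s i≤m) = begin
      2 ^ (k ∸ suc i) + 7    ≤⟨ +-monoˡ-≤ 7 (^-monoʳ-≤ 2 (m∸n≤m (suc m) i)) ⟩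
      x + 7                  ≤⟨ +-monoʳ-≤ x (≤-trans (n≤1+n 7) (+-mono-≤ (*-monoʳ-≤ 3 2≤x) 2≤y)) ⟩
      x + (3 * x + y)        ≡⟨ rearrange x y ⟩
      2 ^ suc k + y          ∎
    where
    open ≤-Reasoning
    x = 2 ^ suc m
    y = 2 ^ suc i
    2≤x : 2 ≤ x
    2≤x = *-monoʳ-≤ 2 (m^n>0 2 m)
    2≤y : 2 ≤ y
    2≤y = *-monoʳ-≤ 2 (m^n>0 2 i)
    rearrange : ∀ x y → x + (3 * x + y) ≡ 2 * (2 * x) + y
    rearrange = solve-∀

  ∑cA : ∑< (suc m) (λ i → c i * A i) ≡ N * 2 ^ suc k + P
  ∑cA = trans (∑<-cong (suc m) (λ {i} _ → *-distribˡ-+ (c i) (2 ^ suc k) (2 ^ suc i)))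
        (trans (∑<-+ (suc m) (λ i → c i * 2 ^ suc k) (λ i → c i * 2 ^ suc i))
               (cong (_+ P) (∑<-*ʳ (suc m) c (2 ^ suc k))))

  ∑cB : ∑< (suc m) (λ i → c i * B i) ≡ P + N * 7
  ∑cB = trans (∑<-cong (suc m) (λ {i} _ → *-distribˡ-+ (c i) (2 ^ (k ∸ suc i)) 7))
        (trans (∑<-+ (suc m) (λ i → c i * 2 ^ (k ∸ suc i)) (λ i → c i * 7))
          (cong₂ _+_ (∑<-binomial-weight-symmetric m) (∑<-*ʳ (suc m) c 7)))

  W+∑cB : wienerFormula2 k + (P + N * 7) ≡ N * 2 ^ suc k + P
  W+∑cB = begin
      wienerFormula2 k + (P + N * 7)
    ≡⟨ cong₂ _+_ (sum-map-applyUpTo (λ t → (k C t) * (2 ^ suc k + 2 ^ t ∸ (2 ^ (k ∸ t) + 7))) suc (suc m))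
                 (sym ∑cB) ⟩
      ∑< (suc m) (λ i → c i * (A i ∸ B i)) + ∑< (suc m) (λ i → c i * B i)
    ≡⟨ cong (_+ ∑< (suc m) (λ i → c i * B i)) (∑<-cong (suc m) (λ {i} _ → *-distribˡ-∸ (c i) (A i) (B i))) ⟩
      ∑< (suc m) (λ i → c i * A i ∸ c i * B i) + ∑< (suc m) (λ i → c i * B i)
    ≡⟨ ∑<-∸ (suc m) _ _ (λ {i} i<1+m → *-monoʳ-≤ (c i) (B≤A i<1+m)) ⟩
      ∑< (suc m) (λ i → c i * A i)
    ≡⟨ ∑cA ⟩
      N * 2 ^ suc k + P
    ∎
    where open ≡-Reasoning

  2^k≡N+2 : 2 ^ k ≡ N + 2
  2^k≡N+2 = sym (∑<-interior-binomial m)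

  2^k∸2≡N : 2 ^ k ∸ 2 ≡ N
  2^k∸2≡N = trans (cong (_∸ 2) 2^k≡N+2) (m+n∸n≡m N 2)

  W+3N≡2NN : wienerFormula2 k + 3 * N ≡ 2 * N * N
  W+3N≡2NN = +-cancelʳ-≡ (4 * N + P) _ _ (begin
      wienerFormula2 k + 3 * N + (4 * N + P)   ≡⟨ rearrangeˡ (wienerFormula2 k) N P ⟩
      wienerFormula2 k + (P + N * 7)           ≡⟨ W+∑cB ⟩
      N * (2 * 2 ^ k) + P                      ≡⟨ cong (λ t → N * (2 * t) + P) 2^k≡N+2 ⟩
      N * (2 * (N + 2)) + P                    ≡⟨ rearrangeʳ N P ⟩
      2 * N * N + (4 * N + P)                  ∎)
    where
    open ≡-Reasoning
    rearrangeˡ : ∀ w n p → w + 3 * n + (4 * n + p) ≡ w + (p + n * 7)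
    rearrangeˡ = solve-∀
    rearrangeʳ : ∀ n p → n * (2 * (n + 2)) + p ≡ 2 * n * n + (4 * n + p)
    rearrangeʳ = solve-∀

  goal : wienerFormula2 k + 3 * (2 ^ k ∸ 2) ≡ 2 * (2 ^ k ∸ 2) * (2 ^ k ∸ 2)
  goal rewrite 2^k∸2≡N = W+3N≡2NN

-- Squarefree numbers and divisors of a product of distinct primes

1<_<_ : ℕ → ℕ → Set
1< x < n = 1 < x × x < n

1<?_<?_ : ∀ x n → Dec (1< x < n)
1<? x <? n = (1 ℕ.<? x) ×-dec (x ℕ.<? n)

SquareFree : ℕ → Set
SquareFree n = ∀ m → m * m ∣ n → m ≡ 1

∣-nonzero : ∀ {g n} → n ≢ 0 → g ∣ n → g ≢ 0
∣-nonzero n≢0 g∣n refl = n≢0 (0∣⇒≡0 g∣n)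

∣-∸ : ∀ {d m n} → d ∣ m → d ∣ n → d ∣ m ∸ n
∣-∸ {d} (divides a refl) (divides b refl) = divides (a ∸ b) (sym (*-distribʳ-∸ d a b))

≢0∧≢1⇒1< : ∀ {g} → g ≢ 0 → g ≢ 1 → 1 < g
≢0∧≢1⇒1< g≢0 g≢1 = ≤∧≢⇒< (n≢0⇒n>0 g≢0) (λ 1≡g → g≢1 (sym 1≡g))

coprime-refl⇒≡1 : ∀ {g} → Coprime g g → g ≡ 1
coprime-refl⇒≡1 c = c (∣-refl , ∣-refl)

coprime∧1<⇒≢ : ∀ {x y} → Coprime x y → 1 < x → x ≢ y
coprime∧1<⇒≢ x⊥y 1<x refl = >⇒≢ 1<x (coprime-refl⇒≡1 x⊥y)

∣-coprimeˡ : ∀ {a b d} → d ∣ a → Coprime a b → Coprime d b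
∣-coprimeˡ d∣a c (e∣d , e∣b) = c (∣-trans e∣d d∣a , e∣b)

coprime∧∣⇒≡1 : ∀ {x g} → Coprime x g → x ∣ g → x ≡ 1
coprime∧∣⇒≡1 c x∣g = c (∣-refl , x∣g)

coprime∧∣*⇒≡1 : ∀ {x g h} → Coprime x g → Coprime x h → x ∣ g * h → x ≡ 1
coprime∧∣*⇒≡1 cg ch x∣gh = coprime∧∣⇒≡1 ch (coprime-divisor cg x∣gh)

coprime∧∣∧∣⇒*∣ : ∀ {a b x} → Coprime a b → a ∣ x → b ∣ x → a * b ∣ x
coprime∧∣∧∣⇒*∣ {a} {b} c a∣x (divides q refl) =
  *-monoˡ-∣ b (coprime-divisor c (subst (a ∣_) (*-comm q b) a∣x))

module Cofactor (n : ℕ) (n≢0 : n ≢ 0) (squareFree : SquareFree n) where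

  cofactor : ℕ → ℕ
  cofactor zero    = 0
  cofactor (suc g) = n / suc g

  *-cofactor : ∀ {g} → g ∣ n → g * cofactor g ≡ n
  *-cofactor {zero}  g∣n = ⊥-elim (∣-nonzero n≢0 g∣n refl)
  *-cofactor {suc g} g∣n = m*[n/m]≡n g∣n

  cofactor∣n : ∀ {g} → g ∣ n → cofactor g ∣ n
  cofactor∣n {g} g∣n = divides g (sym (*-cofactor g∣n))

  cofactor≢0 : ∀ {g} → g ∣ n → cofactor g ≢ 0
  cofactor≢0 g∣n = ∣-nonzero n≢0 (cofactor∣n g∣n)

  *≡n⇒coprime : ∀ {g h} → g * h ≡ n → Coprime g h
  *≡n⇒coprime gh≡n (d∣g , d∣h) = squareFree _ (subst (_ ∣_) gh≡n (*-pres-∣ d∣g d∣h))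

  coprime-cofactor : ∀ {g} → g ∣ n → Coprime g (cofactor g)
  coprime-cofactor g∣n = *≡n⇒coprime (*-cofactor g∣n)

  cofactor-involutive : ∀ {g} → g ∣ n → cofactor (cofactor g) ≡ g
  cofactor-involutive {g} g∣n = *-cancelˡ-≡ _ _ (cofactor g) {{≢-nonZero (cofactor≢0 g∣n)}}
    (trans (*-cofactor (cofactor∣n g∣n)) (trans (sym (*-cofactor g∣n)) (*-comm g (cofactor g))))

  cofactor-injective : ∀ {g h} → g ∣ n → h ∣ n → cofactor g ≡ cofactor h → g ≡ h
  cofactor-injective g∣n h∣n eq =
    trans (sym (cofactor-involutive g∣n)) (trans (cong cofactor eq) (cofactor-involutive h∣n))

  1<cofactor : ∀ {g} → g ∣ n → g < n → 1 < cofactor g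
  1<cofactor {g} g∣n g<n with cofactor g | *-cofactor g∣n | cofactor≢0 g∣n
  ... | zero        | _  | c≢0 = ⊥-elim (c≢0 refl)
  ... | suc zero    | eq | _   = ⊥-elim (<-irrefl (trans (sym (*-identityʳ g)) eq) g<n)
  ... | suc (suc _) | _  | _   = s≤s (s≤s z≤n)

  cofactor<n : ∀ {g} → g ∣ n → 1 < g → cofactor g < n
  cofactor<n {g} g∣n 1<g = subst (cofactor g <_) (trans (*-comm _ g) (*-cofactor g∣n))
    (m<m*n (cofactor g) g {{≢-nonZero (cofactor≢0 g∣n)}} 1<g)

  ≢cofactor : ∀ {g} → g ∣ n → 1 < g → g ≢ cofactor g
  ≢cofactor g∣n = coprime∧1<⇒≢ (coprime-cofactor g∣n)

  coprime⇒n∣cofactor*cofactor : ∀ {g h} → Coprime g h → g ∣ n → h ∣ n → n ∣ cofactor g * cofactor h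
  coprime⇒n∣cofactor*cofactor {g} {h} c g∣n h∣n with coprime∧∣∧∣⇒*∣ c g∣n h∣n
  ... | divides q n≡q*gh = divides q (*-cancelˡ-≡ _ _ (g * h) {{≢-nonZero gh≢0}} (begin
      g * h * (cofactor g * cofactor h)   ≡⟨ rearrange g h (cofactor g) (cofactor h) ⟩
      (g * cofactor g) * (h * cofactor h) ≡⟨ cong₂ _*_ (*-cofactor g∣n) (*-cofactor h∣n) ⟩
      n * n                               ≡⟨ cong (_* n) n≡q*gh ⟩
      q * (g * h) * n                     ≡⟨ rearrange′ q (g * h) n ⟩
      g * h * (q * n)                     ∎))
    where
    open ≡-Reasoning
    gh≢0 : g * h ≢ 0
    gh≢0 = ∣-nonzero n≢0 (coprime∧∣∧∣⇒*∣ c g∣n h∣n)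
    rearrange : ∀ a b c d → a * b * (c * d) ≡ (a * c) * (b * d)
    rearrange = solve-∀
    rearrange′ : ∀ q m n → q * m * n ≡ m * (q * n)
    rearrange′ = solve-∀

  n∣cofactor*cofactor⇒coprime : ∀ {g h} → g ∣ n → h ∣ n → n ∣ cofactor g * cofactor h → Coprime g h
  n∣cofactor*cofactor⇒coprime g∣n h∣n n∣gʹhʹ (d∣g , d∣h) =
    coprime∧∣*⇒≡1 (∣-coprimeˡ d∣g (coprime-cofactor g∣n)) (∣-coprimeˡ d∣h (coprime-cofactor h∣n))
      (∣-trans (∣-trans d∣g g∣n) n∣gʹhʹ)

  n∣square⇒≡n : ∀ {g} → g ∣ n → n ∣ g * g → g ≡ n
  n∣square⇒≡n {g} g∣n n∣gg = begin
      g                ≡⟨ *-identityʳ g ⟨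
      g * 1            ≡⟨ cong (g *_) cofactor≡1 ⟨
      g * cofactor g   ≡⟨ *-cofactor g∣n ⟩
      n                ∎
    where
    open ≡-Reasoning
    cofactor∣g : cofactor g ∣ g
    cofactor∣g = *-cancelˡ-∣ g {{≢-nonZero (∣-nonzero n≢0 g∣n)}} (subst (_∣ g * g) (sym (*-cofactor g∣n)) n∣gg)
    cofactor≡1 : cofactor g ≡ 1
    cofactor≡1 = coprime∧∣⇒≡1 (Coprime.sym (coprime-cofactor g∣n)) cofactor∣g

prime⇒1< : ∀ {p} → Prime p → 1 < p
prime⇒1< {p} p-prime = nonTrivial⇒n>1 p {{prime⇒nonTrivial p-prime}}

prime∣prime⇒≡ : ∀ {p q} → Prime p → Prime q → p ∣ q → p ≡ q
prime∣prime⇒≡ p-prime q-prime p∣q with prime⇒irreducible q-prime p∣q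
... | inj₁ refl = ⊥-elim (<-irrefl refl (prime⇒1< p-prime))
... | inj₂ p≡q  = p≡q

prime∤product : ∀ {p qs} → Prime p → All Prime qs → All (p ≢_) qs → ¬ p ∣ product qs
prime∤product {qs = []}     p-prime []            []            p∣1 = <-irrefl (sym (∣1⇒≡1 p∣1)) (prime⇒1< p-prime)
prime∤product {qs = q ∷ qs} p-prime (q-prime ∷ P) (p≢q ∷ p≢qs) p∣q*qs
  with euclidsLemma q (product qs) p-prime p∣q*qs
... | inj₁ p∣q  = p≢q (prime∣prime⇒≡ p-prime q-prime p∣q)
... | inj₂ p∣qs = prime∤product p-prime P p≢qs p∣qs

prime∤⇒coprime : ∀ {p x} → Prime p → ¬ p ∣ x → Coprime x p
prime∤⇒coprime p-prime p∤x (d∣x , d∣p) with prime⇒irreducible p-prime d∣p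
... | inj₁ d≡1 = d≡1
... | inj₂ refl = ⊥-elim (p∤x d∣x)

productOfDistinctPrimes-squareFree : ∀ {ps} → All Prime ps → Unique ps → SquareFree (product ps)
productOfDistinctPrimes-squareFree {[]} _ _ m m*m∣1 = m*n≡1⇒m≡1 m m (∣1⇒≡1 m*m∣1)
productOfDistinctPrimes-squareFree {p ∷ ps} (p-prime ∷ P) (p∉ps ∷ U) m m*m∣n with p ∣? m
... | yes (divides q refl) = ⊥-elim (prime∤product p-prime P p∉ps
        (*-cancelˡ-∣ p {{prime⇒nonZero p-prime}} (∣-trans (*-pres-∣ (n∣m*n q) (n∣m*n q)) m*m∣n)))
... | no p∤m = productOfDistinctPrimes-squareFree P U m (coprime-divisor m*m⊥p m*m∣n)
  where
  p∤m*m : ¬ p ∣ m * m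
  p∤m*m p∣m*m with euclidsLemma m m p-prime p∣m*m
  ... | inj₁ p∣m = p∤m p∣m
  ... | inj₂ p∣m = p∤m p∣m
  m*m⊥p : Coprime (m * m) p
  m*m⊥p = prime∤⇒coprime p-prime p∤m*m

divisors : List ℕ → List ℕ
divisors []       = 1 ∷ []
divisors (p ∷ ps) = divisors ps ++ map (p *_) (divisors ps)

∈-divisors⁺ : ∀ {ps x} → x ∈ divisors ps → x ∣ product ps
∈-divisors⁺ {[]}     (here refl) = ∣-refl
∈-divisors⁺ {p ∷ ps} x∈ with ∈-++⁻ (divisors ps) x∈
... | inj₁ x∈ds = ∣n⇒∣m*n p (∈-divisors⁺ {ps} x∈ds)
... | inj₂ x∈pds with ∈-map⁻ (p *_) x∈pds
...   | y , y∈ds , refl = *-monoʳ-∣ p (∈-divisors⁺ {ps} y∈ds)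

∈-divisors⁻ : ∀ {ps x} → All Prime ps → Unique ps → x ∣ product ps → x ∈ divisors ps
∈-divisors⁻ {[]}         _ _ x∣1 = here (∣1⇒≡1 x∣1)
∈-divisors⁻ {p ∷ ps} {x} (p-prime ∷ P) (_ ∷ U) x∣n with p ∣? x
... | yes (divides q refl) = ∈-++⁺ʳ (divisors ps) (subst (_∈ map (p *_) (divisors ps)) (*-comm p q)
        (∈-map⁺ (p *_) (∈-divisors⁻ P U
          (*-cancelˡ-∣ p {{prime⇒nonZero p-prime}} (subst (_∣ p * product ps) (*-comm q p) x∣n)))))
... | no p∤x = ∈-++⁺ˡ (∈-divisors⁻ P U (coprime-divisor (prime∤⇒coprime p-prime p∤x) x∣n))

divisors-unique : ∀ {ps} → All Prime ps → Unique ps → Unique (divisors ps)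
divisors-unique {[]}     _ _ = [] ∷ []
divisors-unique {p ∷ ps} (p-prime ∷ P) (p∉ps ∷ U) =
  Unique.++⁺ IH (Unique.map⁺ (*-cancelˡ-≡ _ _ p {{prime⇒nonZero p-prime}}) IH) disjoint
  where
  IH = divisors-unique P U
  disjoint : ∀ {v} → ¬ (v ∈ divisors ps × v ∈ map (p *_) (divisors ps))
  disjoint (v∈ds , v∈pds) with ∈-map⁻ (p *_) v∈pds
  ... | y , _ , refl = prime∤product p-prime P p∉ps (∣-trans (m∣m*n y) (∈-divisors⁺ {ps} v∈ds))

length-divisors : ∀ ps → length (divisors ps) ≡ 2 ^ length ps
length-divisors []       = refl
length-divisors (p ∷ ps) = begin
    length (divisors ps ++ map (p *_) (divisors ps))
  ≡⟨ length-++ (divisors ps) ⟩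
    length (divisors ps) + length (map (p *_) (divisors ps))
  ≡⟨ cong (length (divisors ps) +_) (length-map (p *_) (divisors ps)) ⟩
    length (divisors ps) + length (divisors ps)
  ≡⟨ cong (λ l → l + l) (length-divisors ps) ⟩
    2 ^ length ps + 2 ^ length ps
  ≡⟨ cong (2 ^ length ps +_) (+-identityʳ _) ⟨
    2 * 2 ^ length ps
  ∎
  where open ≡-Reasoning

∣∧¬1<x<n⇒≡1⊎≡n : ∀ {x n} → n ≢ 0 → x ∣ n → ¬ 1< x < n → x ≡ 1 ⊎ x ≡ n
∣∧¬1<x<n⇒≡1⊎≡n {x} {n} n≢0 x∣n ¬1<x<n with x ℕ.≟ 1
... | yes x≡1 = inj₁ x≡1
... | no x≢1  = inj₂ (≤∧≮⇒≡ (∣⇒≤ {{≢-nonZero n≢0}} x∣n)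
                           (λ x<n → ¬1<x<n (≢0∧≢1⇒1< (∣-nonzero n≢0 x∣n) x≢1 , x<n)))

nontrivialDivisors : List ℕ → List ℕ
nontrivialDivisors ps = filter (λ x → 1<? x <? product ps) (divisors ps)

module _ {ps} (P : All Prime ps) (U : Unique ps) where

  ∈-nontrivialDivisors⁺ : ∀ {x} → x ∣ product ps → 1< x < product ps → x ∈ nontrivialDivisors ps
  ∈-nontrivialDivisors⁺ x∣n 1<x<n = ∈-filter⁺ (λ x → 1<? x <? product ps) (∈-divisors⁻ P U x∣n) 1<x<n

  ∈-nontrivialDivisors⁻ : ∀ {x} → x ∈ nontrivialDivisors ps → x ∣ product ps × 1< x < product ps
  ∈-nontrivialDivisors⁻ x∈ with ∈-filter⁻ (λ x → 1<? x <? product ps) {xs = divisors ps} x∈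
  ... | x∈ds , 1<x<n = ∈-divisors⁺ {ps} x∈ds , 1<x<n

  nontrivialDivisors-unique : Unique (nontrivialDivisors ps)
  nontrivialDivisors-unique = Unique.filter⁺ (λ x → 1<? x <? product ps) (divisors-unique P U)

length-nontrivialDivisors : ∀ {ps} → All Prime ps → Unique ps → length (nontrivialDivisors ps) ≡ 2 ^ length ps ∸ 2
length-nontrivialDivisors {[]}         _ _ = refl
length-nontrivialDivisors {ps@(_ ∷ _)} P@(p-prime ∷ _) U = begin
    length (nontrivialDivisors ps)           ≡⟨ m+n∸n≡m _ 2 ⟨
    length (nontrivialDivisors ps) + 2 ∸ 2   ≡⟨ cong (_∸ 2) (+-comm _ 2) ⟩
    length (1 ∷ n ∷ nontrivialDivisors ps) ∸ 2 ≡⟨ cong (_∸ 2) (↭-length ds↭) ⟨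
    length (divisors ps) ∸ 2             ≡⟨ cong (_∸ 2) (length-divisors ps) ⟩
    2 ^ length ps ∸ 2                    ∎
  where
  open ≡-Reasoning
  n = product ps
  n≢0 : n ≢ 0
  n≢0 = ≢-nonZero⁻¹ n {{productOfPrimes≢0 P}}
  1<n : 1 < n
  1<n = <-≤-trans (prime⇒1< p-prime) (m≤m*n _ _ {{productOfPrimes≢0 (All.tail P)}})
  unique : Unique (1 ∷ n ∷ nontrivialDivisors ps)
  unique = (<⇒≢ 1<n ∷ All.tabulate (λ y∈ → <⇒≢ (proj₁ (proj₂ (∈-nontrivialDivisors⁻ P U y∈)))))
         ∷ All.tabulate (λ y∈ → >⇒≢ (proj₂ (proj₂ (∈-nontrivialDivisors⁻ P U y∈))))
         ∷ nontrivialDivisors-unique P U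
  ds↭ : divisors ps ↭ 1 ∷ n ∷ nontrivialDivisors ps
  ds↭ = unique∧set⇒↭ (divisors-unique P U) unique (mk⇔ to from)
    where
    to : ∀ {x} → x ∈ divisors ps → x ∈ 1 ∷ n ∷ nontrivialDivisors ps
    to {x} x∈ with 1<? x <? n
    ... | yes 1<x<n = there (there (∈-nontrivialDivisors⁺ P U (∈-divisors⁺ {ps} x∈) 1<x<n))
    ... | no ¬1<x<n with ∣∧¬1<x<n⇒≡1⊎≡n n≢0 (∈-divisors⁺ {ps} x∈) ¬1<x<n
    ...   | inj₁ x≡1 = here x≡1
    ...   | inj₂ x≡n = there (here x≡n)
    from : ∀ {x} → x ∈ 1 ∷ n ∷ nontrivialDivisors ps → x ∈ divisors ps
    from (here refl)         = ∈-divisors⁻ P U (1∣ n)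
    from (there (here refl)) = ∈-divisors⁻ P U ∣-refl
    from (there (there x∈))  = ∈-divisors⁻ P U (proj₁ (∈-nontrivialDivisors⁻ P U x∈))

-- Ideals of ℤ_n

least-witness : ∀ {p} {P : Pred ℕ p} → Decidable P → ∀ N {j} → j ≤ N → P j →
                ∃ λ m → P m × (∀ {i} → i < m → ¬ P i)
least-witness P? N {j} j≤N pj with anyUpTo? P? j
... | no ∄i = j , pj , λ i<j pi → ∄i (_ , i<j , pi)
least-witness P? zero    j≤0 pj | yes (i , i<j , _)  = ⊥-elim (n≮0 (<-≤-trans i<j j≤0))
least-witness P? (suc N) j≤N pj | yes (i , i<j , pi) = least-witness P? N (s≤s⁻¹ (<-≤-trans i<j j≤N)) pi

module _ {n p} {P : Pred (Fin n) p} (P? : Decidable P) where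

  ∈-tabulate⁺ : ∀ {a} → P a → a ∈ˢ tabulate (λ b → does (P? b))
  ∈-tabulate⁺ {a} pa = lookup⇒[]= a _ (trans (lookup∘tabulate _ a) (dec-true (P? a) pa))

  ∈-tabulate⁻ : ∀ {a} → a ∈ˢ tabulate (λ b → does (P? b)) → P a
  ∈-tabulate⁻ {a} a∈ with P? a | trans (sym (lookup∘tabulate (λ b → does (P? b)) a)) ([]=⇒lookup a∈)
  ... | yes pa | _ = pa

module PrincipalIdeals (n : ℕ) .{{_ : NonZero n}} where
  open Zn n

  toℕ-mod : ∀ x → toℕ (x mod n) ≡ x % n
  toℕ-mod x = toℕ-fromℕ< _

  mod-cong : ∀ {x y} → x % n ≡ y % n → x mod n ≡ y mod n
  mod-cong {x} {y} eq = toℕ-injective (trans (toℕ-mod x) (trans eq (sym (toℕ-mod y))))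

  mod-+ₙ-mod : ∀ x y → (x mod n) +ₙ (y mod n) ≡ (x + y) mod n
  mod-+ₙ-mod x y = mod-cong (trans (cong₂ (λ u v → (u + v) % n) (toℕ-mod x) (toℕ-mod y))
                                   (sym (%-distribˡ-+ x y n)))

  mod-*ₙ-mod : ∀ x y → (x mod n) *ₙ (y mod n) ≡ (x * y) mod n
  mod-*ₙ-mod x y = mod-cong (trans (cong₂ (λ u v → (u * v) % n) (toℕ-mod x) (toℕ-mod y))
                                   (sym (%-distribˡ-* x y n)))

  toℕ-mod-toℕ : ∀ (a : Fin n) → toℕ a mod n ≡ a
  toℕ-mod-toℕ a = toℕ-injective (trans (toℕ-mod (toℕ a)) (m<n⇒m%n≡m (toℕ<n a)))

  toℕ-0ₙ : toℕ 0ₙ ≡ 0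
  toℕ-0ₙ = trans (toℕ-mod 0) (m<n⇒m%n≡m (>-nonZero⁻¹ n))

  toℕ≢0⇒≢0ₙ : ∀ {a} → toℕ a ≢ 0 → a ≢ 0ₙ
  toℕ≢0⇒≢0ₙ toℕa≢0 refl = toℕa≢0 toℕ-0ₙ

  ≢0ₙ⇒toℕ≢0 : ∀ {a} → a ≢ 0ₙ → toℕ a ≢ 0
  ≢0ₙ⇒toℕ≢0 a≢0 toℕa≡0 = a≢0 (toℕ-injective (trans toℕa≡0 (sym toℕ-0ₙ)))

  ∣toℕ-mod : ∀ {d x} → d ∣ n → d ∣ x → d ∣ toℕ (x mod n)
  ∣toℕ-mod {x = x} d∣n d∣x = subst (_ ∣_) (sym (toℕ-mod x)) (%-presˡ-∣ d∣x d∣n)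

  multiples : ℕ → Subset n
  multiples g = tabulate (λ a → does (g ∣? toℕ a))

  ∈-multiples⁺ : ∀ {g a} → g ∣ toℕ a → a ∈ˢ multiples g
  ∈-multiples⁺ {g} = ∈-tabulate⁺ (λ a → g ∣? toℕ a)

  ∈-multiples⁻ : ∀ {g a} → a ∈ˢ multiples g → g ∣ toℕ a
  ∈-multiples⁻ {g} = ∈-tabulate⁻ (λ a → g ∣? toℕ a)

  fromℕ<∈multiples : ∀ {g} (g<n : g < n) → fromℕ< g<n ∈ˢ multiples g
  fromℕ<∈multiples {g} g<n = ∈-multiples⁺ {g} (subst (g ∣_) (sym (toℕ-fromℕ< g<n)) ∣-refl)

  multiples-isIdeal : ∀ {g} → g ∣ n → IsIdeal (multiples g)
  multiples-isIdeal g∣n = record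
    { zero∈      = ∈-multiples⁺ (∣toℕ-mod g∣n (_ ∣0))
    ; +-closed   = λ _ _ a∈ b∈ →
                     ∈-multiples⁺ (∣toℕ-mod g∣n (∣m∣n⇒∣m+n (∈-multiples⁻ a∈) (∈-multiples⁻ b∈)))
    ; neg-closed = λ _ a∈ → ∈-multiples⁺ (∣toℕ-mod g∣n (∣-∸ g∣n (∈-multiples⁻ a∈)))
    ; absorb     = λ r _ a∈ → ∈-multiples⁺ (∣toℕ-mod g∣n (∣n⇒∣m*n (toℕ r) (∈-multiples⁻ a∈)))
    }

  multiples-injective : ∀ {g h} → g < n → h < n → multiples g ≡ multiples h → g ≡ h
  multiples-injective g<n h<n eq = ∣-antisym
    (subst (_ ∣_) (toℕ-fromℕ< h<n) (∈-multiples⁻ (subst (_ ∈ˢ_) (sym eq) (fromℕ<∈multiples h<n))))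
    (subst (_ ∣_) (toℕ-fromℕ< g<n) (∈-multiples⁻ (subst (_ ∈ˢ_) eq (fromℕ<∈multiples g<n))))

  module _ {I : Subset n} (isIdeal : IsIdeal I) where
    open IsIdeal isIdeal

    _∈ᴵ : ℕ → Set
    x ∈ᴵ = x mod n ∈ˢ I

    *-closedᴺ : ∀ q {x} → x ∈ᴵ → (q * x) ∈ᴵ
    *-closedᴺ q {x} x∈ = subst (_∈ˢ I) (mod-*ₙ-mod q x) (absorb (q mod n) (x mod n) x∈)

    +-closedᴺ : ∀ {x y} → x ∈ᴵ → y ∈ᴵ → (x + y) ∈ᴵ
    +-closedᴺ {x} {y} x∈ y∈ = subst (_∈ˢ I) (mod-+ₙ-mod x y) (+-closed _ _ x∈ y∈)

    -- (n ∸ 1) * x represents −x.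
    +-cancelˡᴺ : ∀ {x y} → (x + y) ∈ᴵ → x ∈ᴵ → y ∈ᴵ
    +-cancelˡᴺ {x} {y} x+y∈ x∈ = subst (_∈ˢ I) (mod-cong (begin
        (x + y + (n ∸ 1) * x) % n ≡⟨ cong (_% n) (rearrange x y (n ∸ 1)) ⟩
        (y + suc (n ∸ 1) * x) % n ≡⟨ cong (λ m → (y + m * x) % n) (suc-pred n) ⟩
        (y + n * x) % n           ≡⟨ %-remove-+ʳ y (m∣m*n x) ⟩
        y % n                     ∎)) (+-closedᴺ x+y∈ (*-closedᴺ (n ∸ 1) x∈))
      where
      open ≡-Reasoning
      rearrange : ∀ x y m → x + y + m * x ≡ y + suc m * x
      rearrange = solve-∀

    toℕ∈ᴵ : ∀ {a} → a ∈ˢ I → toℕ a ∈ᴵ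
    toℕ∈ᴵ {a} a∈ = subst (_∈ˢ I) (sym (toℕ-mod-toℕ a)) a∈

    n∈ᴵ : n ∈ᴵ
    n∈ᴵ = subst (_∈ˢ I) (mod-cong (trans (m<n⇒m%n≡m (>-nonZero⁻¹ n)) (sym (n%n≡0 n)))) zero∈

    isIdeal⇒principal : ∃ λ g → g ∣ n × I ≡ multiples g
    isIdeal⇒principal with least-witness (λ m → (1 ≤? m) ×-dec (m mod n ∈ˢ? I)) n ≤-refl (>-nonZero⁻¹ n , n∈ᴵ)
    ... | g , (1≤g , g∈) , below =
      g , ∈ᴵ⇒g∣ n∈ᴵ , ⊆-antisym (λ a∈ → ∈-multiples⁺ (∈ᴵ⇒g∣ (toℕ∈ᴵ a∈)))
                                (λ {a} a∈ → subst (_∈ˢ I) (toℕ-mod-toℕ a) (g∣⇒∈ᴵ (∈-multiples⁻ a∈)))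
      where
      instance
        g≢0 : NonZero g
        g≢0 = >-nonZero 1≤g
      ∈ᴵ⇒g∣ : ∀ {x} → x ∈ᴵ → g ∣ x
      ∈ᴵ⇒g∣ {x} x∈ with x % g in x%g≡r
      ... | zero  = m%n≡0⇒n∣m x g x%g≡r
      ... | suc r = ⊥-elim (below (subst (_< g) x%g≡r (m%n<n x g)) (s≤s z≤n , subst _∈ᴵ x%g≡r r∈))
        where
        r∈ : (x % g) ∈ᴵ
        r∈ = +-cancelˡᴺ (subst _∈ᴵ (trans (m≡m%n+[m/n]*n x g) (+-comm (x % g) _)) x∈) (*-closedᴺ (x / g) g∈)
      g∣⇒∈ᴵ : ∀ {x} → g ∣ x → x ∈ᴵ
      g∣⇒∈ᴵ (divides q refl) = *-closedᴺ q g∈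

module EssentialSums (n : ℕ) .{{_ : NonZero n}} where
  open Zn n
  open PrincipalIdeals n

  isVertex⇒bounds : ∀ {g} → g ∣ n → IsVertex (multiples g) → 1< g < n
  isVertex⇒bounds {g} g∣n (_ , (a , a∈ , a≢0) , proper) = 1<g , g<n
    where
    g<n : g < n
    g<n = <-≤-trans (s≤s (∣⇒≤ {{≢-nonZero (≢0ₙ⇒toℕ≢0 a≢0)}} (∈-multiples⁻ a∈))) (toℕ<n a)
    g≢1 : g ≢ 1
    g≢1 refl = proper (λ b → ∈-multiples⁺ (1∣ _))
    1<g : 1 < g
    1<g = ≢0∧≢1⇒1< (∣-nonzero (≢-nonZero⁻¹ n) g∣n) g≢1

  multiples-isVertex : ∀ {g} → g ∣ n → 1 < g → g < n → IsVertex (multiples g)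
  multiples-isVertex {g} g∣n 1<g g<n =
    multiples-isIdeal g∣n , (fromℕ< g<n , fromℕ<∈multiples g<n , g≢0ₙ) , proper
    where
    g≢0ₙ : fromℕ< g<n ≢ 0ₙ
    g≢0ₙ = toℕ≢0⇒≢0ₙ (λ eq → >⇒≢ (<-trans z<s 1<g) (trans (sym (toℕ-fromℕ< g<n)) eq))
    proper : Proper (multiples g)
    proper all∈ = >⇒≢ 1<g (∣1⇒≡1 (subst (g ∣_) (toℕ-fromℕ< 1<n) (∈-multiples⁻ (all∈ (fromℕ< 1<n)))))
      where
      1<n : 1 < n
      1<n = <-trans 1<g g<n

  IdealSum-comm : ∀ {I K z} → IdealSum I K z → IdealSum K I z
  IdealSum-comm (b , c , b∈ , c∈ , z≡b+c) =
    c , b , c∈ , b∈ , trans z≡b+c (cong (_mod n) (+-comm (toℕ b) (toℕ c)))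

  -- With n ∸ 1 standing for −1, the summands t x g and t y h (n ∸ 1) add up to t modulo n.
  bézout⇒IdealSum-total : ∀ {g h} x y → g ∣ n → h ∣ n → 1 + y * h ≡ x * g →
                          ∀ z → IdealSum (multiples g) (multiples h) z
  bézout⇒IdealSum-total {g} {h} x y g∣n h∣n 1+yh≡xg z =
    (t * x * g) mod n , (t * y * h * (n ∸ 1)) mod n ,
    ∈-multiples⁺ (∣toℕ-mod g∣n (n∣m*n (t * x))) ,
    ∈-multiples⁺ (∣toℕ-mod h∣n (∣m⇒∣m*n (n ∸ 1) (n∣m*n (t * y)))) ,
    sym (begin
      ((t * x * g) mod n) +ₙ ((t * y * h * (n ∸ 1)) mod n) ≡⟨ mod-+ₙ-mod (t * x * g) _ ⟩
      (t * x * g + t * y * h * (n ∸ 1)) mod n              ≡⟨ cong (_mod n) arith ⟩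
      (t + t * y * h * n) mod n                            ≡⟨ mod-cong (%-remove-+ʳ t (n∣m*n (t * y * h))) ⟩
      t mod n                                              ≡⟨ toℕ-mod-toℕ z ⟩
      z                                                    ∎)
    where
    open ≡-Reasoning
    t = toℕ z
    rearrange : ∀ t y h m → t * (1 + y * h) + t * y * h * m ≡ t + t * y * h * suc m
    rearrange = solve-∀
    arith : t * x * g + t * y * h * (n ∸ 1) ≡ t + t * y * h * n
    arith = begin
      t * x * g + t * y * h * (n ∸ 1)       ≡⟨ cong (_+ t * y * h * (n ∸ 1)) (*-assoc t x g) ⟩
      t * (x * g) + t * y * h * (n ∸ 1)     ≡⟨ cong (λ s → t * s + t * y * h * (n ∸ 1)) 1+yh≡xg ⟨
      t * (1 + y * h) + t * y * h * (n ∸ 1) ≡⟨ rearrange t y h (n ∸ 1) ⟩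
      t + t * y * h * suc (n ∸ 1)           ≡⟨ cong (λ m → t + t * y * h * m) (suc-pred n) ⟩
      t + t * y * h * n                     ∎

  coprime⇒essential : ∀ {g h} → g ∣ n → h ∣ n → Coprime g h →
                      Essential (IdealSum (multiples g) (multiples h))
  coprime⇒essential {g} {h} g∣n h∣n g⊥h J _ (a , a∈J , a≢0) = a , total a , a∈J , a≢0
    where
    total : ∀ z → IdealSum (multiples g) (multiples h) z
    total with coprime-Bézout g⊥h
    ... | Bézout.+- x y 1+yh≡xg = bézout⇒IdealSum-total x y g∣n h∣n 1+yh≡xg
    ... | Bézout.-+ x y 1+xg≡yh = λ z → IdealSum-comm (bézout⇒IdealSum-total y x h∣n g∣n 1+xg≡yh z)

  module _ (squareFree : SquareFree n) where
    open Cofactor n (≢-nonZero⁻¹ n) squareFree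

    common-divisor⇒¬essential : ∀ {g h d} → g ∣ n → d ∣ g → d ∣ h → 1 < d →
                                ¬ Essential (IdealSum (multiples g) (multiples h))
    common-divisor⇒¬essential {g} {h} {d} g∣n d∣g d∣h 1<d essential =
      meets-only-0 (essential (multiples d′) (multiples-isIdeal d′∣n)
                              (fromℕ< d′<n , fromℕ<∈multiples d′<n , d′≢0ₙ))
      where
      d∣n : d ∣ n
      d∣n = ∣-trans d∣g g∣n
      d′ = cofactor d
      d′∣n : d′ ∣ n
      d′∣n = cofactor∣n d∣n
      d′<n : d′ < n
      d′<n = cofactor<n d∣n 1<d
      d′≢0ₙ : fromℕ< d′<n ≢ 0ₙ
      d′≢0ₙ = toℕ≢0⇒≢0ₙ (λ eq → cofactor≢0 d∣n (trans (sym (toℕ-fromℕ< d′<n)) eq))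
      meets-only-0 : ¬ ∃ λ a → IdealSum (multiples g) (multiples h) a × a ∈ˢ multiples d′ × a ≢ 0ₙ
      meets-only-0 (a , (b , c , b∈ , c∈ , a≡b+c) , a∈ , a≢0) = ≢0ₙ⇒toℕ≢0 a≢0 toℕa≡0
        where
        d∣a : d ∣ toℕ a
        d∣a = subst (d ∣_) (cong toℕ (sym a≡b+c))
          (∣toℕ-mod d∣n (∣m∣n⇒∣m+n (∣-trans d∣g (∈-multiples⁻ b∈)) (∣-trans d∣h (∈-multiples⁻ c∈))))
        n∣a : n ∣ toℕ a
        n∣a = subst (_∣ toℕ a) (*-cofactor d∣n) (coprime∧∣∧∣⇒*∣ (coprime-cofactor d∣n) d∣a (∈-multiples⁻ a∈))
        toℕa≡0 : toℕ a ≡ 0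
        toℕa≡0 = trans (sym (m<n⇒m%n≡m (toℕ<n a))) (n∣m⇒m%n≡0 _ n n∣a)

    essential⇒coprime : ∀ {g h} → g ∣ n →
                        Essential (IdealSum (multiples g) (multiples h)) → Coprime g h
    essential⇒coprime g∣n essential {d} (d∣g , d∣h) with d ≟ 1
    ... | yes d≡1 = d≡1
    ... | no d≢1  = ⊥-elim (common-divisor⇒¬essential g∣n d∣g d∣h 1<d essential)
      where 1<d = ≢0∧≢1⇒1< (∣-nonzero (≢-nonZero⁻¹ n) (∣-trans d∣g g∣n)) d≢1

-- The essential ideal graph

module EssentialIdealGraph {ps : List ℕ} (P : All Prime ps) (U : Unique ps) where

  n : ℕ
  n = product ps

  instance
    n-nonZero : NonZero n
    n-nonZero = productOfPrimes≢0 P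

  squareFree : SquareFree n
  squareFree = productOfDistinctPrimes-squareFree P U

  open Cofactor n (≢-nonZero⁻¹ n) squareFree

  divs : List ℕ
  divs = nontrivialDivisors ps

  ∈divs⇒∣n : ∀ {g} → g ∈ divs → g ∣ n
  ∈divs⇒∣n g∈divs = proj₁ (∈-nontrivialDivisors⁻ P U g∈divs)

  ∈divs⇒bounds : ∀ {g} → g ∈ divs → 1< g < n
  ∈divs⇒bounds g∈divs = proj₂ (∈-nontrivialDivisors⁻ P U g∈divs)

  distanceBy : ∀ {g h} → Dec (h ≡ g) → Dec (Coprime g h) → Dec (n ∣ g * h) → ℕ
  distanceBy (yes _) _       _       = 0
  distanceBy (no _)  (yes _) _       = 1
  distanceBy (no _)  (no _)  (yes _) = 3
  distanceBy (no _)  (no _)  (no _)  = 2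

  distance : ℕ → ℕ → ℕ
  distance g h = distanceBy (h ≟ g) (coprime? g h) (n ∣? g * h)

  distance-refl : ∀ g → distance g g ≡ 0
  distance-refl g = go (g ≟ g)
    where
    go : ∀ D₁ {D₂ D₃} → distanceBy {g} {g} D₁ D₂ D₃ ≡ 0
    go (yes _)  = refl
    go (no g≢g) = ⊥-elim (g≢g refl)

  distance-sym : ∀ g h → distance g h ≡ distance h g
  distance-sym g h = go (h ≟ g) (coprime? g h) (n ∣? g * h) (g ≟ h) (coprime? h g) (n ∣? h * g)
    where
    go : ∀ D₁ D₂ D₃ E₁ E₂ E₃ → distanceBy {g} {h} D₁ D₂ D₃ ≡ distanceBy {h} {g} E₁ E₂ E₃
    go (yes _)   _        _        (yes _)   _        _        = refl
    go (yes h≡g) _        _        (no g≢h)  _        _        = ⊥-elim (g≢h (sym h≡g))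
    go (no h≢g)  _        _        (yes g≡h) _        _        = ⊥-elim (h≢g (sym g≡h))
    go (no _)    (yes _)  _        (no _)    (yes _)  _        = refl
    go (no _)    (yes c)  _        (no _)    (no ¬c)  _        = ⊥-elim (¬c (Coprime.sym c))
    go (no _)    (no ¬c)  _        (no _)    (yes c)  _        = ⊥-elim (¬c (Coprime.sym c))
    go (no _)    (no _)   (yes _)  (no _)    (no _)   (yes _)  = refl
    go (no _)    (no _)   (no _)   (no _)    (no _)   (no _)   = refl
    go (no _)    (no _)   (yes d)  (no _)    (no _)   (no ¬d)  = ⊥-elim (¬d (subst (n ∣_) (*-comm g h) d))
    go (no _)    (no _)   (no ¬d)  (no _)    (no _)   (yes d)  = ⊥-elim (¬d (subst (n ∣_) (*-comm h g) d))

  cofactor∈divs : ∀ {g} → g ∈ divs → cofactor g ∈ divs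
  cofactor∈divs g∈divs with ∈divs⇒bounds g∈divs
  ... | 1<g , g<n = ∈-nontrivialDivisors⁺ P U (cofactor∣n g∣n) (1<cofactor g∣n g<n , cofactor<n g∣n 1<g)
    where g∣n = ∈divs⇒∣n g∈divs

  sum-map-cofactor : ∀ f → sum (map (λ g → f (cofactor g)) divs) ≡ sum (map f divs)
  sum-map-cofactor f = trans (cong sum (map-∘ {g = f} {f = cofactor} divs)) (sum-↭ (map⁺ f cofactor-divs↭divs))
    where
    cofactor-divs↭divs : map cofactor divs ↭ divs
    cofactor-divs↭divs = unique∧set⇒↭
      (Unique-map⁺-local cofactor (λ x∈ y∈ → cofactor-injective (∈divs⇒∣n x∈) (∈divs⇒∣n y∈))
                                  (nontrivialDivisors-unique P U))
      (nontrivialDivisors-unique P U)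
      (mk⇔ to from)
      where
      to : ∀ {x} → x ∈ map cofactor divs → x ∈ divs
      to x∈ with ∈-map⁻ cofactor x∈
      ... | y , y∈divs , refl = cofactor∈divs y∈divs
      from : ∀ {x} → x ∈ divs → x ∈ map cofactor divs
      from x∈divs = subst (_∈ map cofactor divs) (cofactor-involutive (∈divs⇒∣n x∈divs))
                          (∈-map⁺ cofactor (cofactor∈divs x∈divs))

  distance-counting : ∀ {g h} → g ∈ divs → h ∈ divs →
    distance g h + 2 when (h ≟ g) + 1 when coprime? g h + 1 when (h ≟ cofactor g) ≡ 2 + 1 when (n ∣? g * h)
  distance-counting {g} {h} g∈divs h∈divs = go (h ≟ g) (coprime? g h) (n ∣? g * h) (h ≟ cofactor g)
    where
    g∣n = ∈divs⇒∣n g∈divs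
    1<g = proj₁ (∈divs⇒bounds g∈divs)
    g<n = proj₂ (∈divs⇒bounds g∈divs)
    h≡cofactor : Coprime g h → n ∣ g * h → h ≡ cofactor g
    h≡cofactor g⊥h n∣gh = *-cancelˡ-≡ h (cofactor g) g {{≢-nonZero (∣-nonzero (≢-nonZero⁻¹ n) g∣n)}}
      (trans (∣-antisym (coprime∧∣∧∣⇒*∣ g⊥h g∣n (∈divs⇒∣n h∈divs)) n∣gh) (sym (*-cofactor g∣n)))
    go : ∀ D₁ D₂ D₃ (D₄ : Dec (h ≡ cofactor g)) →
         distanceBy D₁ D₂ D₃ + 2 when D₁ + 1 when D₂ + 1 when D₄ ≡ 2 + 1 when D₃
    go (yes refl) (yes g⊥g) _           _           = ⊥-elim (>⇒≢ 1<g (coprime-refl⇒≡1 g⊥g))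
    go (yes refl) (no _)    (yes n∣gg)  _           = ⊥-elim (<⇒≢ g<n (n∣square⇒≡n g∣n n∣gg))
    go (yes refl) (no _)    (no _)      (yes g≡g′)  = ⊥-elim (≢cofactor g∣n 1<g g≡g′)
    go (yes refl) (no _)    (no _)      (no _)      = refl
    go (no _)     (yes _)   (yes _)     (yes _)     = refl
    go (no _)     (yes g⊥h) (yes n∣gh)  (no h≢g′)   = ⊥-elim (h≢g′ (h≡cofactor g⊥h n∣gh))
    go (no _)     (yes _)   (no n∤gh)   (yes refl)  = ⊥-elim (n∤gh (subst (n ∣_) (sym (*-cofactor g∣n)) ∣-refl))
    go (no _)     (yes _)   (no _)      (no _)      = refl
    go (no _)     (no ¬g⊥h) _           (yes refl)  = ⊥-elim (¬g⊥h (coprime-cofactor g∣n))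
    go (no _)     (no _)    (yes _)     (no _)      = refl
    go (no _)     (no _)    (no _)      (no _)      = refl

  N : ℕ
  N = length divs

  coprimeCount complementCount : ℕ → ℕ
  coprimeCount    g = sum (map (λ h → 1 when coprime? g h) divs)
  complementCount g = sum (map (λ h → 1 when (n ∣? g * h)) divs)

  distance-row : ∀ {g} → g ∈ divs → sum (map (distance g) divs) + 2 + coprimeCount g + 1 ≡ 2 * N + complementCount g
  distance-row {g} g∈divs = begin
      sum (map (distance g) divs) + 2 + coprimeCount g + 1
    ≡⟨ cong₂ (λ u v → sum (map (distance g) divs) + u + coprimeCount g + v)
         (sum-map-when-∈ 2 (_≟ g) (nontrivialDivisors-unique P U) g∈divs)
         (sum-map-when-∈ 1 (_≟ cofactor g) (nontrivialDivisors-unique P U) (cofactor∈divs g∈divs)) ⟨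
      sum (map (distance g) divs) + sum (map d₁ divs) + sum (map d₂ divs) + sum (map d₃ divs)
    ≡⟨ cong (λ s → s + sum (map d₂ divs) + sum (map d₃ divs)) (sum-map-+ (distance g) d₁ divs) ⟨
      sum (map (λ h → distance g h + d₁ h) divs) + sum (map d₂ divs) + sum (map d₃ divs)
    ≡⟨ cong (_+ sum (map d₃ divs)) (sum-map-+ (λ h → distance g h + d₁ h) d₂ divs) ⟨
      sum (map (λ h → distance g h + d₁ h + d₂ h) divs) + sum (map d₃ divs)
    ≡⟨ sum-map-+ (λ h → distance g h + d₁ h + d₂ h) d₃ divs ⟨
      sum (map (λ h → distance g h + d₁ h + d₂ h + d₃ h) divs)
    ≡⟨ sum-map-cong∈ divs (distance-counting g∈divs) ⟩
      sum (map (λ h → 2 + 1 when (n ∣? g * h)) divs)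
    ≡⟨ sum-map-+ (λ _ → 2) (λ h → 1 when (n ∣? g * h)) divs ⟩
      sum (map (λ _ → 2) divs) + complementCount g
    ≡⟨ cong (_+ complementCount g) (sum-map-const 2 divs) ⟩
      2 * N + complementCount g
    ∎
    where
    open ≡-Reasoning
    d₁ d₂ d₃ : ℕ → ℕ
    d₁ h = 2 when (h ≟ g)
    d₂ h = 1 when coprime? g h
    d₃ h = 1 when (h ≟ cofactor g)

  ∑coprimeCount≡∑complementCount : sum (map coprimeCount divs) ≡ sum (map complementCount divs)
  ∑coprimeCount≡∑complementCount = begin
      sum (map coprimeCount divs)
    ≡⟨ sum-map-cong∈ divs (λ {g} g∈divs → sum-map-cong∈ divs (λ {h} h∈divs → when-⇔ {P = Coprime g h} 1
         (λ g⊥h → coprime⇒n∣cofactor*cofactor g⊥h (∈divs⇒∣n g∈divs) (∈divs⇒∣n h∈divs))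
         (n∣cofactor*cofactor⇒coprime (∈divs⇒∣n g∈divs) (∈divs⇒∣n h∈divs))
         (coprime? g h) (n ∣? cofactor g * cofactor h))) ⟩
      sum (map (λ g → sum (map (λ h → 1 when (n ∣? cofactor g * cofactor h)) divs)) divs)
    ≡⟨ sum-map-cong∈ divs (λ {g} _ → sum-map-cofactor (λ h → 1 when (n ∣? cofactor g * h))) ⟩
      sum (map (λ g → complementCount (cofactor g)) divs)
    ≡⟨ sum-map-cofactor complementCount ⟩
      sum (map complementCount divs)
    ∎
    where open ≡-Reasoning

  ∑∑distance : sum (map (λ g → sum (map (distance g) divs)) divs) + 3 * N ≡ 2 * N * N
  ∑∑distance = +-cancelʳ-≡ (sum (map coprimeCount divs)) _ _ (begin
      S + 3 * N + ∑coprime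
    ≡⟨ rearrange S N ∑coprime ⟩
      S + 2 * N + ∑coprime + 1 * N
    ≡⟨ cong₂ (λ u v → S + u + ∑coprime + v) (sum-map-const 2 divs) (sum-map-const 1 divs) ⟨
      S + sum (map (λ _ → 2) divs) + ∑coprime + sum (map (λ _ → 1) divs)
    ≡⟨ cong (λ s → s + ∑coprime + sum (map (λ _ → 1) divs)) (sum-map-+ row (λ _ → 2) divs) ⟨
      sum (map (λ g → row g + 2) divs) + ∑coprime + sum (map (λ _ → 1) divs)
    ≡⟨ cong (_+ sum (map (λ _ → 1) divs)) (sum-map-+ (λ g → row g + 2) coprimeCount divs) ⟨
      sum (map (λ g → row g + 2 + coprimeCount g) divs) + sum (map (λ _ → 1) divs)
    ≡⟨ sum-map-+ (λ g → row g + 2 + coprimeCount g) (λ _ → 1) divs ⟨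
      sum (map (λ g → row g + 2 + coprimeCount g + 1) divs)
    ≡⟨ sum-map-cong∈ divs distance-row ⟩
      sum (map (λ g → 2 * N + complementCount g) divs)
    ≡⟨ sum-map-+ (λ _ → 2 * N) complementCount divs ⟩
      sum (map (λ _ → 2 * N) divs) + sum (map complementCount divs)
    ≡⟨ cong₂ _+_ (sum-map-const (2 * N) divs) (sym ∑coprimeCount≡∑complementCount) ⟩
      2 * N * N + ∑coprime
    ∎)
    where
    open ≡-Reasoning
    row : ℕ → ℕ
    row g = sum (map (distance g) divs)
    S = sum (map row divs)
    ∑coprime = sum (map coprimeCount divs)
    rearrange : ∀ s n a → s + 3 * n + a ≡ s + 2 * n + a + 1 * n
    rearrange = solve-∀

  module Enumeration {V : ℕ} (vs : Fin V → Subset n) (vs-injective : Injective _≡_ _≡_ vs)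
                     (vs-isVertex : ∀ i → Zn.IsVertex n (vs i))
                     (vs-complete : ∀ I → Zn.IsVertex n I → ∃ λ i → vs i ≡ I) where

    open Zn n
    open PrincipalIdeals n
    open EssentialSums n

    Adj : Fin V → Fin V → Set
    Adj i j = EAdj (vs i) (vs j)

    open Graph Adj using (Walk; IsDistance; here; step)

    private
      principal : ∀ i → ∃ λ g → g ∣ n × vs i ≡ multiples g
      principal i = isIdeal⇒principal (proj₁ (vs-isVertex i))

    generator : Fin V → ℕ
    generator i = proj₁ (principal i)

    generator∣n : ∀ i → generator i ∣ n
    generator∣n i = proj₁ (proj₂ (principal i))

    vs≡multiples : ∀ i → vs i ≡ multiples (generator i)
    vs≡multiples i = proj₂ (proj₂ (principal i))

    generator-bounds : ∀ i → 1< generator i < n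
    generator-bounds i = isVertex⇒bounds (generator∣n i) (subst IsVertex (vs≡multiples i) (vs-isVertex i))

    generator∈divs : ∀ i → generator i ∈ divs
    generator∈divs i = ∈-nontrivialDivisors⁺ P U (generator∣n i) (generator-bounds i)

    generator-injective : ∀ {i j} → generator i ≡ generator j → i ≡ j
    generator-injective {i} {j} eq = vs-injective (trans (vs≡multiples i) (trans (cong multiples eq) (sym (vs≡multiples j))))

    generator-surjective : ∀ {x} → x ∈ divs → ∃ λ i → generator i ≡ x
    generator-surjective x∈divs with ∈-nontrivialDivisors⁻ P U x∈divs
    ... | x∣n , 1<x , x<n with vs-complete _ (multiples-isVertex x∣n 1<x x<n)
    ...   | i , vsi≡ = i , multiples-injective (proj₂ (generator-bounds i)) x<n (trans (sym (vs≡multiples i)) vsi≡)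

    adjacent⁺ : ∀ {i j} → generator i ≢ generator j → Coprime (generator i) (generator j) → Adj i j
    adjacent⁺ {i} {j} gi≢gj gi⊥gj =
      (λ vsi≡vsj → gi≢gj (cong generator (vs-injective vsi≡vsj))) ,
      subst₂ (λ I K → Essential (IdealSum I K)) (sym (vs≡multiples i)) (sym (vs≡multiples j))
        (coprime⇒essential (generator∣n i) (generator∣n j) gi⊥gj)

    adjacent⁻ : ∀ {i j} → Adj i j → Coprime (generator i) (generator j)
    adjacent⁻ {i} {j} (_ , essential) = essential⇒coprime squareFree (generator∣n i)
      (subst₂ (λ I K → Essential (IdealSum I K)) (vs≡multiples i) (vs≡multiples j) essential)

    adjacent-via : ∀ {i j x y} → generator i ≡ x → generator j ≡ y → x ≢ y → Coprime x y → Adj i j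
    adjacent-via refl refl = adjacent⁺

    walk-length≥2 : ∀ {i j} → generator j ≢ generator i → ¬ Coprime (generator i) (generator j) →
                    ∀ {m} → Walk i j m → 2 ≤ m
    walk-length≥2 gj≢gi _   {zero}        w = ⊥-elim (gj≢gi (cong generator (sym (walk₀⇒≡ w))))
    walk-length≥2 _     ¬gi⊥gj {suc zero} w = ⊥-elim (¬gi⊥gj (adjacent⁻ (walk₁⇒adjacent w)))
    walk-length≥2 _     _   {suc (suc _)} _ = s≤s (s≤s z≤n)

    isDistance-equal : ∀ {i j} → generator j ≡ generator i → IsDistance i j 0
    isDistance-equal {i} gj≡gi = subst (λ k → Walk i k 0) (generator-injective (sym gj≡gi)) here , λ _ _ → z≤n

    isDistance-coprime : ∀ {i j} → generator j ≢ generator i → Coprime (generator i) (generator j) → IsDistance i j 1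
    isDistance-coprime {i} {j} gj≢gi gi⊥gj = step (adjacent⁺ (λ e → gj≢gi (sym e)) gi⊥gj) here , lower
      where
      lower : ∀ m → Walk i j m → 1 ≤ m
      lower zero    w = ⊥-elim (gj≢gi (cong generator (sym (walk₀⇒≡ w))))
      lower (suc _) _ = s≤s z≤n

    isDistance-cofactors : ∀ {i j} → generator j ≢ generator i → ¬ Coprime (generator i) (generator j) →
                           n ∣ generator i * generator j → IsDistance i j 3
    isDistance-cofactors {i} {j} gj≢gi ¬gi⊥gj n∣gh = step i~u (step u~v (step v~j here)) , lower
      where
      g = generator i
      h = generator j
      g∣n = generator∣n i
      h∣n = generator∣n j
      u = proj₁ (generator-surjective (cofactor∈divs (generator∈divs i)))
      v = proj₁ (generator-surjective (cofactor∈divs (generator∈divs j)))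
      gu≡g′ = proj₂ (generator-surjective (cofactor∈divs (generator∈divs i)))
      gv≡h′ = proj₂ (generator-surjective (cofactor∈divs (generator∈divs j)))
      i~u : Adj i u
      i~u = adjacent-via refl gu≡g′ (≢cofactor g∣n (proj₁ (generator-bounds i))) (coprime-cofactor g∣n)
      u~v : Adj u v
      u~v = adjacent-via gu≡g′ gv≡h′ (λ e → gj≢gi (sym (cofactor-injective g∣n h∣n e)))
        (n∣cofactor*cofactor⇒coprime (cofactor∣n g∣n) (cofactor∣n h∣n)
          (subst₂ (λ a b → n ∣ a * b) (sym (cofactor-involutive g∣n)) (sym (cofactor-involutive h∣n)) n∣gh))
      v~j : Adj v j
      v~j = adjacent-via gv≡h′ refl (λ e → ≢cofactor h∣n (proj₁ (generator-bounds j)) (sym e))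
        (Coprime.sym (coprime-cofactor h∣n))
      lower : ∀ m → Walk i j m → 3 ≤ m
      lower zero w with walk-length≥2 gj≢gi ¬gi⊥gj w
      ... | ()
      lower (suc zero) w with walk-length≥2 gj≢gi ¬gi⊥gj w
      ... | s≤s ()
      lower (suc (suc zero)) w with walk₂⇒commonNeighbour w
      ... | k , i~k , k~j = ⊥-elim (>⇒≢ (proj₁ (generator-bounds k))
            (coprime∧∣*⇒≡1 (Coprime.sym (adjacent⁻ i~k)) (adjacent⁻ k~j) (∣-trans (generator∣n k) n∣gh)))
      lower (suc (suc (suc _))) _ = s≤s (s≤s (s≤s z≤n))

    isDistance-commonNeighbour : ∀ {i j} → generator j ≢ generator i → ¬ Coprime (generator i) (generator j) →
                                 ¬ n ∣ generator i * generator j → IsDistance i j 2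
    isDistance-commonNeighbour {i} {j} gj≢gi ¬gi⊥gj n∤gh =
      step i~w (step w~j here) , λ _ → walk-length≥2 gj≢gi ¬gi⊥gj
      where
      g = generator i
      h = generator j
      g∣n = generator∣n i
      h∣n = generator∣n j
      x = gcd (cofactor g) (cofactor h)
      x∣g′ : x ∣ cofactor g
      x∣g′ = gcd[m,n]∣m (cofactor g) (cofactor h)
      x⊥g : Coprime x g
      x⊥g = ∣-coprimeˡ x∣g′ (Coprime.sym (coprime-cofactor g∣n))
      x⊥h : Coprime x h
      x⊥h = ∣-coprimeˡ (gcd[m,n]∣n (cofactor g) (cofactor h)) (Coprime.sym (coprime-cofactor h∣n))
      x≢1 : x ≢ 1
      x≢1 x≡1 = n∤gh (subst₂ (λ a b → n ∣ a * b) (cofactor-involutive g∣n) (cofactor-involutive h∣n)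
        (coprime⇒n∣cofactor*cofactor (gcd≡1⇒coprime x≡1) (cofactor∣n g∣n) (cofactor∣n h∣n)))
      1<x : 1 < x
      1<x = ≢0∧≢1⇒1< (λ x≡0 → cofactor≢0 g∣n (gcd[m,n]≡0⇒m≡0 x≡0)) x≢1
      x<n : x < n
      x<n = ≤-<-trans (∣⇒≤ {{≢-nonZero (cofactor≢0 g∣n)}} x∣g′) (cofactor<n g∣n (proj₁ (generator-bounds i)))
      x∈divs : x ∈ divs
      x∈divs = ∈-nontrivialDivisors⁺ P U (∣-trans x∣g′ (cofactor∣n g∣n)) (1<x , x<n)
      w = proj₁ (generator-surjective x∈divs)
      gw≡x = proj₂ (generator-surjective x∈divs)
      i~w : Adj i w
      i~w = adjacent-via refl gw≡x (coprime∧1<⇒≢ (Coprime.sym x⊥g) (proj₁ (generator-bounds i))) (Coprime.sym x⊥g)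
      w~j : Adj w j
      w~j = adjacent-via gw≡x refl (coprime∧1<⇒≢ x⊥h 1<x) x⊥h

    isDistance : ∀ i j → IsDistance i j (distance (generator i) (generator j))
    isDistance i j = go (generator j ≟ generator i) (coprime? (generator i) (generator j)) (n ∣? generator i * generator j)
      where
      go : ∀ D₁ D₂ D₃ → IsDistance i j (distanceBy D₁ D₂ D₃)
      go (yes gj≡gi) _            _          = isDistance-equal gj≡gi
      go (no gj≢gi)  (yes gi⊥gj)  _          = isDistance-coprime gj≢gi gi⊥gj
      go (no gj≢gi)  (no ¬gi⊥gj)  (yes n∣gh) = isDistance-cofactors gj≢gi ¬gi⊥gj n∣gh
      go (no gj≢gi)  (no ¬gi⊥gj)  (no n∤gh)  = isDistance-commonNeighbour gj≢gi ¬gi⊥gj n∤gh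

    sum-map-generator : ∀ f → sum (map (λ i → f (generator i)) (allFin V)) ≡ sum (map f divs)
    sum-map-generator f = trans (cong sum (map-∘ {g = f} {f = generator} (allFin V))) (sum-↭ (map⁺ f generators↭divs))
      where
      generators↭divs : map generator (allFin V) ↭ divs
      generators↭divs = unique∧set⇒↭
        (Unique.map⁺ generator-injective (Unique.allFin⁺ V)) (nontrivialDivisors-unique P U) (mk⇔ to from)
        where
        to : ∀ {x} → x ∈ map generator (allFin V) → x ∈ divs
        to x∈ with ∈-map⁻ generator x∈
        ... | i , _ , refl = generator∈divs i
        from : ∀ {x} → x ∈ divs → x ∈ map generator (allFin V)
        from x∈divs = subst (_∈ map generator (allFin V)) (proj₂ s) (∈-map⁺ generator (∈-allFin (proj₁ s)))
          where s = generator-surjective x∈divs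

    d : Fin V → Fin V → ℕ
    d i j = distance (generator i) (generator j)

    2*wiener≡wienerFormula2 : 2 * Graph.wiener Adj d ≡ wienerFormula2 (length ps)
    2*wiener≡wienerFormula2 = begin
        2 * Graph.wiener Adj d
      ≡⟨ wiener-symmetric Adj d (λ i j → distance-sym _ _) (λ i → distance-refl _) ⟩
        sum (map (λ i → sum (map (d i) (allFin V))) (allFin V))
      ≡⟨ sum-map-cong∈ (allFin V) (λ {i} _ → sum-map-generator (distance (generator i))) ⟩
        sum (map (λ i → sum (map (distance (generator i)) divs)) (allFin V))
      ≡⟨ sum-map-generator (λ g → sum (map (distance g) divs)) ⟩
        sum (map (λ g → sum (map (distance g) divs)) divs)
      ≡⟨ +-cancelʳ-≡ (3 * N) _ _ (trans ∑∑distance (sym closedForm)) ⟩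
        wienerFormula2 (length ps)
      ∎
      where
      open ≡-Reasoning
      closedForm : wienerFormula2 (length ps) + 3 * N ≡ 2 * N * N
      closedForm rewrite length-nontrivialDivisors P U = wienerFormula2-closedForm (length ps)

mainTheorem16 : (n : ℕ) .{{_ : NonZero n}} (ps : List ℕ) →
    All Prime ps → Unique ps → n ≡ product ps →
    -- any enumeration vs : Fin V → Subset n of the vertex set (nonzero proper ideals of ℤ_n)
    (V : ℕ) (vs : Fin V → Subset n) → Injective _≡_ _≡_ vs →
    (∀ i → Zn.IsVertex n (vs i)) →
    (∀ I → Zn.IsVertex n I → ∃ λ i → vs i ≡ I) →
    -- the graph is connected, with distance function d, and 2 W = Σ_{t=1}^{k-1} ...
    Σ (Fin V → Fin V → ℕ) λ d →
      (∀ i j → Graph.IsDistance (λ a b → Zn.EAdj n (vs a) (vs b)) i j (d i j)) ×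
      2 * Graph.wiener (λ a b → Zn.EAdj n (vs a) (vs b)) d ≡ wienerFormula2 (length ps)
mainTheorem16 .(product ps) ps P U refl V vs vs-injective vs-isVertex vs-complete =
  d , isDistance , 2*wiener≡wienerFormula2
  where open EssentialIdealGraph.Enumeration P U vs vs-injective vs-isVertex vs-complete
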